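{- Let $\Delta$ be a lexicographically shellable $q$-complex on $\mathbb{F}_q^n$ of dimension $k$, and let $\mathfrak{U}=\{U_1\subset\cdots\subset U_k=F_j\}$ be a maximal chain of $K(\mathring\Delta)$ ending in the facet $F_j$. Let $x$ be the $\prec$-minimum nonzero vector of $\mathbb{F}_q^n$ with $\langle x\rangle\in\Delta$. If $x\in F_j$, then $\mathcal{R}(\mathfrak{U})\neq\mathfrak{U}$.
   Context: Let $q$ be a prime power. Fix a total order $\prec$ on $\mathbb{F}_q$ with $0\prec1\prec x$ for all $x\in\mathbb{F}_q\setminus\{0,1\}$, extended lexicographically to $\mathbb{F}_q^n$. For distinct subspaces $U,V$ of the same dimension, $U\prec_q V$ iff $\min(U\setminus V)\prec\min(V\setminus U)$. A $q$-complex on $\mathbb{F}_q^n$ is a set of subspaces closed under taking subspaces; facets are maximal elements. It is lexicographically shellable if all facets have the same dimension $k$ and, with facets listed $F_1\prec_q\cdots\prec_q F_t$, for all $i<j$ there is $m<j$ with $F_i\cap F_j\subseteq F_m\cap F_j$ and $\dim(F_m\cap F_j)=k-1$. $\mathring\Delta=\Delta\setminus\{\{0\}\}$ and $K(\mathring\Delta)$ is its order complex, whose maximal chains are $\{U_1\subset\cdots\subset U_k\}$ with $\dim U_i=i$. Maximal chains are ordered by $\prec_l$: $\mathfrak{U}\prec_l\mathfrak{V}$ iff they differ and $U_e\prec_q V_e$ for the largest $e$ with $U_e\ne V_e$. The restriction is $\mathcal{R}(\mathfrak{U})=\{U\in\mathfrak{U}:\ \mathfrak{U}\setminus\{U\}\subseteq\mathfrak{V}\text{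 for some maximal chain }\mathfrak{V}\prec_l\mathfrak{U}\}$. -}

module Defs where

open import Level using (0ℓ)
open import Data.Nat using (ℕ; zero; suc; _∸_; _<_)
open import Data.Fin using (Fin; toℕ)
open import Data.Vec using (Vec; []; _∷_; zipWith; map; replicate; foldr)
open import Data.List using (List)
open import Data.List.Membership.Propositional using (_∈_)
open import Data.Product using (Σ; ∃; _×_; _,_)
open import Data.Sum using (_⊎_)
open import Relation.Nullary using (¬_; Dec)
open import Relation.Binary.PropositionalEquality using (_≡_; _≢_)
open import Relation.Binary.Structures using (IsStrictTotalOrder)
open import Algebra.Structures using (IsCommutativeRing)

-- A finite field (laws stated with propositional equality).
-- Its number of elements q is automatically a prime power.

record FiniteField : Set₁ where
  field
    Carrier  : Set
    _+_ _*_  : Carrier → Carrier → Carrier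
    -_       : Carrier → Carrier
    0# 1#    : Carrier
    isCommutativeRing : IsCommutativeRing _≡_ _+_ _*_ -_ 0# 1#
    0≢1      : 0# ≢ 1#
    inverse  : ∀ x → x ≢ 0# → Σ Carrier (λ y → x * y ≡ 1#)
    _≟_      : (x y : Carrier) → Dec (x ≡ y)
    elements : List Carrier
    complete : ∀ x → x ∈ elements

record AdmissibleOrder (F : FiniteField) : Set₁ where
  open FiniteField F
  field
    _≺_ : Carrier → Carrier → Set
    isStrictTotalOrder : IsStrictTotalOrder _≡_ _≺_
    0≺1 : 0# ≺ 1#
    1≺x : ∀ x → x ≢ 0# → x ≢ 1# → 1# ≺ x

module Setup (F : FiniteField) (O : AdmissibleOrder F) (n : ℕ) where
  open FiniteField F
  open AdmissibleOrder O

  V : Set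
  V = Vec Carrier n

  _+v_ : ∀ {m} → Vec Carrier m → Vec Carrier m → Vec Carrier m
  _+v_ = zipWith _+_

  _·v_ : ∀ {m} → Carrier → Vec Carrier m → Vec Carrier m
  c ·v u = map (c *_) u

  0v : ∀ {m} → Vec Carrier m
  0v = replicate _ 0#

  data _≺v_ : ∀ {m} → Vec Carrier m → Vec Carrier m → Set where
    here  : ∀ {m x y} {u w : Vec Carrier m} → x ≺ y → (x ∷ u) ≺v (y ∷ w)
    there : ∀ {m x} {u w : Vec Carrier m} → u ≺v w → (x ∷ u) ≺v (x ∷ w)

  Sub : Set₁
  Sub = V → Set

  _⊆_ : Sub → Sub → Set
  U ⊆ W = ∀ v → U v → W v

  _≐_ : Sub → Sub → Set
  U ≐ W = (U ⊆ W) × (W ⊆ U)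

  _∩_ : Sub → Sub → Sub
  (U ∩ W) v = U v × W v

  _∖_ : Sub → Sub → Sub
  (U ∖ W) v = U v × ¬ W v

  IsMin : Sub → V → Set
  IsMin P m = P m × (∀ y → P y → (m ≡ y) ⊎ (m ≺v y))

  IsSubspace : Sub → Set
  IsSubspace U = U 0v × (∀ u w → U u → U w → U (u +v w))
                      × (∀ c u → U u → U (c ·v u))

  lincomb : ∀ {d} → Vec Carrier d → Vec V d → V
  lincomb [] [] = 0v
  lincomb (c ∷ cs) (b ∷ bs) = (c ·v b) +v lincomb cs bs

  Dim : Sub → ℕ → Set
  Dim U d = Σ (Vec V d) λ b →
              (∀ c → lincomb c b ≡ 0v → c ≡ 0v)
            × (∀ u → U u → Σ (Vec Carrier d) λ c → lincomb c b ≡ u)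
            × (∀ c → U (lincomb c b))

  ⟨_⟩ : V → Sub
  ⟨ x ⟩ v = Σ Carrier λ c → v ≡ c ·v x

  _≺q_ : Sub → Sub → Set
  U ≺q W = Σ V λ a → Σ V λ b → IsMin (U ∖ W) a × IsMin (W ∖ U) b × a ≺v b

  Complex : Set₁
  Complex = Sub → Set

  IsQComplex : Complex → Set₁
  IsQComplex Δ = (∀ U → Δ U → IsSubspace U)
               × (∀ U W → Δ U → IsSubspace W → W ⊆ U → Δ W)

  IsFacet : Complex → Sub → Set₁
  IsFacet Δ F' = Δ F' × (∀ W → Δ W → F' ⊆ W → W ⊆ F')

  LexShellable : Complex → ℕ → Set₁
  LexShellable Δ k =
      (∀ F' → IsFacet Δ F' → Dim F' k)
    × (∀ Fi Fj → IsFacet Δ Fi → IsFacet Δ Fj → Fi ≺q Fj →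
         Σ Sub λ Fm → IsFacet Δ Fm × Fm ≺q Fj
                     × ((Fi ∩ Fj) ⊆ (Fm ∩ Fj)) × Dim (Fm ∩ Fj) (k ∸ 1))

  -- chains U_1 ⊂ … ⊂ U_k, indexed by Fin k (index i stands for U_{i+1})
  Chain : ℕ → Set₁
  Chain k = Fin k → Sub

  IsMaxChain : Complex → (k : ℕ) → Chain k → Set
  IsMaxChain Δ k C =
      (∀ i → Δ (C i) × Dim (C i) (suc (toℕ i)))
    × (∀ i j → toℕ i < toℕ j → C i ⊆ C j)

  _≺l_ : ∀ {k} → Chain k → Chain k → Set
  C ≺l D = Σ _ λ e → ¬ (C e ≐ D e)
                   × (∀ e' → toℕ e < toℕ e' → C e' ≐ D e')
                   × C e ≺q D e

  InRestriction : Complex → (k : ℕ) → Chain k → Fin k → Set₁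
  InRestriction Δ k C e =
    Σ (Chain k) λ D → IsMaxChain Δ k D × D ≺l C
                    × (∀ i → i ≢ e → Σ (Fin k) λ l → C i ≐ D l)

module Submission where

-- Let U_e be the first member of the chain containing x.  If U_e lay in the restriction, an
-- earlier maximal chain D would differ from the given one exactly at position e (dimensions
-- force D_i = U_i elsewhere), so D_e ≺_q U_e: the minimum a of D_e ∖ U_e precedes the minimum
-- b of U_e ∖ D_e.  As ⟨a⟩ ∈ Δ, minimality of x gives x ≼ a ≺ b.  But x ∉ D_e, since otherwise
-- D_e ⊇ U_{e-1} + ⟨x⟩ = U_e by a dimension count; so x ∈ U_e ∖ D_e and b ≼ x, a contradiction.

open import Defs
open import Level using (0ℓ)
open import Data.Nat using (ℕ; zero; suc; _<_; _≤_; s≤s)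
open import Data.Nat.Properties using (≤-antisym; ≮⇒≥; m≤n⇒m≤1+n; <-irrefl; suc-injective; ≤-reflexive; <⇒≢)
open import Data.Fin using (Fin; zero; suc; toℕ; inject₁)
import Data.Fin as Fin
open import Data.Fin.Properties using (toℕ-injective; toℕ-inject₁)
open import Data.Fin.Induction using (<-weakInduction)
open import Data.Unit using (⊤; tt)
open import Data.Vec using (Vec; []; _∷_; zipWith; map; replicate; head; tail)
open import Data.Vec.Properties using (zipWith-assoc; zipWith-comm; zipWith-identityˡ; zipWith-identityʳ; map-cong; map-∘; map-id; map-replicate)
open import Data.Vec.Relation.Unary.All as All using (All; []; _∷_)
open import Data.Product using (Σ; _×_; _,_; proj₁; proj₂; swap)
open import Data.Sum using (_⊎_; inj₁; inj₂)
open import Data.Empty using (⊥; ⊥-elim)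
open import Relation.Nullary using (¬_; yes; no)
open import Relation.Binary.PropositionalEquality
open import Relation.Binary.Structures using (IsStrictTotalOrder)
open import Algebra.Structures using (IsCommutativeRing)
open import Algebra.Bundles using (CommutativeRing)

module LinearAlgebra (F : FiniteField) where
  open FiniteField F
  open IsCommutativeRing isCommutativeRing using (+-assoc; +-comm; +-identityˡ; +-identityʳ;
    *-assoc; *-comm; *-identityˡ; *-identityʳ; distribˡ; distribʳ; zeroˡ; zeroʳ; -‿inverseˡ)

  private
    ring : CommutativeRing 0ℓ 0ℓ
    ring = record { isCommutativeRing = isCommutativeRing }
  open import Algebra.Properties.Ring (CommutativeRing.ring ring) using (-‿distribˡ-*; -‿distribʳ-*; +-inverseˡ-unique)
  open ≡-Reasoning

  infixl 6 _⊕_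
  infixl 7 _⊙_

  _⊕_ : ∀ {m} → Vec Carrier m → Vec Carrier m → Vec Carrier m
  _⊕_ = zipWith _+_

  _⊙_ : ∀ {m} → Carrier → Vec Carrier m → Vec Carrier m
  c ⊙ u = map (c *_) u

  𝟘 : ∀ {m} → Vec Carrier m
  𝟘 = replicate _ 0#

  ⊕-assoc : ∀ {m} (u v w : Vec Carrier m) → u ⊕ v ⊕ w ≡ u ⊕ (v ⊕ w)
  ⊕-assoc = zipWith-assoc +-assoc

  ⊕-comm : ∀ {m} (u v : Vec Carrier m) → u ⊕ v ≡ v ⊕ u
  ⊕-comm = zipWith-comm +-comm

  ⊕-identityˡ : ∀ {m} (u : Vec Carrier m) → 𝟘 ⊕ u ≡ u
  ⊕-identityˡ = zipWith-identityˡ +-identityˡ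

  ⊕-identityʳ : ∀ {m} (u : Vec Carrier m) → u ⊕ 𝟘 ≡ u
  ⊕-identityʳ = zipWith-identityʳ +-identityʳ

  ⊕-interchange : ∀ {m} (a b c d : Vec Carrier m) → (a ⊕ b) ⊕ (c ⊕ d) ≡ (a ⊕ c) ⊕ (b ⊕ d)
  ⊕-interchange a b c d = begin
    (a ⊕ b) ⊕ (c ⊕ d) ≡⟨ ⊕-assoc a b (c ⊕ d) ⟩
    a ⊕ (b ⊕ (c ⊕ d)) ≡⟨ cong (a ⊕_) (sym (⊕-assoc b c d)) ⟩
    a ⊕ (b ⊕ c ⊕ d)   ≡⟨ cong (λ z → a ⊕ (z ⊕ d)) (⊕-comm b c) ⟩
    a ⊕ (c ⊕ b ⊕ d)   ≡⟨ cong (a ⊕_) (⊕-assoc c b d) ⟩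
    a ⊕ (c ⊕ (b ⊕ d)) ≡⟨ sym (⊕-assoc a c (b ⊕ d)) ⟩
    (a ⊕ c) ⊕ (b ⊕ d) ∎

  ⊙-assoc : ∀ {m} c d (u : Vec Carrier m) → (c * d) ⊙ u ≡ c ⊙ (d ⊙ u)
  ⊙-assoc c d u = trans (map-cong (*-assoc c d) u) (map-∘ (c *_) (d *_) u)

  ⊙-identityˡ : ∀ {m} (u : Vec Carrier m) → 1# ⊙ u ≡ u
  ⊙-identityˡ u = trans (map-cong *-identityˡ u) (map-id u)

  ⊙-zeroˡ : ∀ {m} (u : Vec Carrier m) → 0# ⊙ u ≡ 𝟘
  ⊙-zeroˡ [] = refl
  ⊙-zeroˡ (a ∷ u) = cong₂ _∷_ (zeroˡ a) (⊙-zeroˡ u)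

  ⊙-zeroʳ : ∀ {m} c → c ⊙ 𝟘 {m} ≡ 𝟘
  ⊙-zeroʳ {m} c = trans (map-replicate (c *_) 0# m) (cong (replicate m) (zeroʳ c))

  ⊙-distribˡ : ∀ {m} c (u v : Vec Carrier m) → c ⊙ (u ⊕ v) ≡ c ⊙ u ⊕ c ⊙ v
  ⊙-distribˡ c [] [] = refl
  ⊙-distribˡ c (a ∷ u) (b ∷ v) = cong₂ _∷_ (distribˡ c a b) (⊙-distribˡ c u v)

  ⊙-distribʳ : ∀ {m} c d (u : Vec Carrier m) → (c + d) ⊙ u ≡ c ⊙ u ⊕ d ⊙ u
  ⊙-distribʳ c d [] = refl
  ⊙-distribʳ c d (a ∷ u) = cong₂ _∷_ (distribʳ a c d) (⊙-distribʳ c d u)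

  lc : ∀ {d m} → Vec Carrier d → Vec (Vec Carrier m) d → Vec Carrier m
  lc [] [] = 𝟘
  lc (c ∷ cs) (b ∷ bs) = c ⊙ b ⊕ lc cs bs

  dot : ∀ {d} → Vec Carrier d → Vec Carrier d → Carrier
  dot [] [] = 0#
  dot (c ∷ cs) (h ∷ hs) = (c * h) + dot cs hs

  dot-zeroˡ : ∀ {d} (hs : Vec Carrier d) → dot 𝟘 hs ≡ 0#
  dot-zeroˡ [] = refl
  dot-zeroˡ (h ∷ hs) = trans (cong₂ _+_ (zeroˡ h) (dot-zeroˡ hs)) (+-identityˡ 0#)

  dot-zeroʳ : ∀ {d} (c : Vec Carrier d) → dot c 𝟘 ≡ 0#
  dot-zeroʳ [] = refl
  dot-zeroʳ (c ∷ cs) = trans (cong₂ _+_ (zeroʳ c) (dot-zeroʳ cs)) (+-identityˡ 0#)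

  lc-zeroˡ : ∀ {d m} (ws : Vec (Vec Carrier m) d) → lc 𝟘 ws ≡ 𝟘
  lc-zeroˡ [] = refl
  lc-zeroˡ (w ∷ ws) = trans (cong₂ _⊕_ (⊙-zeroˡ w) (lc-zeroˡ ws)) (⊕-identityˡ 𝟘)

  lc-⊕ : ∀ {d m} (α β : Vec Carrier d) (ws : Vec (Vec Carrier m) d) → lc (α ⊕ β) ws ≡ lc α ws ⊕ lc β ws
  lc-⊕ [] [] [] = sym (⊕-identityˡ 𝟘)
  lc-⊕ (a ∷ α) (b ∷ β) (w ∷ ws) = begin
    (a + b) ⊙ w ⊕ lc (α ⊕ β) ws           ≡⟨ cong₂ _⊕_ (⊙-distribʳ a b w) (lc-⊕ α β ws) ⟩
    (a ⊙ w ⊕ b ⊙ w) ⊕ (lc α ws ⊕ lc β ws) ≡⟨ ⊕-interchange _ _ _ _ ⟩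
    (a ⊙ w ⊕ lc α ws) ⊕ (b ⊙ w ⊕ lc β ws) ∎

  lc-⊙ : ∀ {d m} c (α : Vec Carrier d) (ws : Vec (Vec Carrier m) d) → lc (c ⊙ α) ws ≡ c ⊙ lc α ws
  lc-⊙ c [] [] = sym (⊙-zeroʳ c)
  lc-⊙ c (a ∷ α) (w ∷ ws) = begin
    (c * a) ⊙ w ⊕ lc (c ⊙ α) ws ≡⟨ cong₂ _⊕_ (⊙-assoc c a w) (lc-⊙ c α ws) ⟩
    c ⊙ (a ⊙ w) ⊕ c ⊙ lc α ws   ≡⟨ sym (⊙-distribˡ c _ _) ⟩
    c ⊙ (a ⊙ w ⊕ lc α ws)       ∎

  lc-lc : ∀ {m d n} (c : Vec Carrier m) (as : Vec (Vec Carrier d) m) (w : Vec (Vec Carrier n) d) →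
          lc c (map (λ a → lc a w) as) ≡ lc (lc c as) w
  lc-lc [] [] w = sym (lc-zeroˡ w)
  lc-lc (c ∷ cs) (a ∷ as) w = begin
    c ⊙ lc a w ⊕ lc cs (map (λ a → lc a w) as) ≡⟨ cong₂ _⊕_ (sym (lc-⊙ c a w)) (lc-lc cs as w) ⟩
    lc (c ⊙ a) w ⊕ lc (lc cs as) w             ≡⟨ sym (lc-⊕ (c ⊙ a) (lc cs as) w) ⟩
    lc (c ⊙ a ⊕ lc cs as) w                    ∎

  lc-head-tail : ∀ {d m} (c : Vec Carrier m) (as : Vec (Vec Carrier (suc d)) m) →
                 lc c as ≡ dot c (map head as) ∷ lc c (map tail as)
  lc-head-tail [] [] = refl
  lc-head-tail (c ∷ cs) ((h ∷ t) ∷ as) = cong (c ⊙ (h ∷ t) ⊕_) (lc-head-tail cs as)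

  lc-eliminate : ∀ {d m} (c : Vec Carrier m) (rs : Vec (Vec Carrier (suc d)) m) (s : Vec Carrier d) →
                 lc c (map (λ r → tail r ⊕ head r ⊙ s) rs) ≡ lc c (map tail rs) ⊕ dot c (map head rs) ⊙ s
  lc-eliminate [] [] s = sym (trans (cong (𝟘 ⊕_) (⊙-zeroˡ s)) (⊕-identityˡ 𝟘))
  lc-eliminate {d} {suc m} (c ∷ cs) ((h ∷ t) ∷ rs) s = begin
    c ⊙ (t ⊕ h ⊙ s) ⊕ lc cs (map (λ r → tail r ⊕ head r ⊙ s) rs)
      ≡⟨ cong₂ _⊕_ (⊙-distribˡ c t (h ⊙ s)) (lc-eliminate cs rs s) ⟩
    (c ⊙ t ⊕ c ⊙ (h ⊙ s)) ⊕ (lc cs ts ⊕ dot cs hs ⊙ s)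
      ≡⟨ ⊕-interchange _ _ _ _ ⟩
    (c ⊙ t ⊕ lc cs ts) ⊕ (c ⊙ (h ⊙ s) ⊕ dot cs hs ⊙ s)
      ≡⟨ cong (λ z → (c ⊙ t ⊕ lc cs ts) ⊕ (z ⊕ dot cs hs ⊙ s)) (sym (⊙-assoc c h s)) ⟩
    (c ⊙ t ⊕ lc cs ts) ⊕ ((c * h) ⊙ s ⊕ dot cs hs ⊙ s)
      ≡⟨ cong ((c ⊙ t ⊕ lc cs ts) ⊕_) (sym (⊙-distribʳ (c * h) (dot cs hs) s)) ⟩
    (c ⊙ t ⊕ lc cs ts) ⊕ ((c * h) + dot cs hs) ⊙ s ∎
    where
    ts : Vec (Vec Carrier d) m
    ts = map tail rs
    hs : Vec Carrier m
    hs = map head rs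

  Dependent : ∀ {d m} → Vec (Vec Carrier d) m → Set
  Dependent as = Σ _ λ c → c ≢ 𝟘 × lc c as ≡ 𝟘

  -- Eliminate the first coordinate of each r ∈ rs using a; a dependency among the reduced tails
  -- lifts, with the coefficient of a chosen to cancel the first coordinate.
  dependent-pivot : ∀ {d m} → (∀ (rs : Vec (Vec Carrier d) m) → Dependent rs) →
                    (a : Vec Carrier (suc d)) (rs : Vec (Vec Carrier (suc d)) m) → head a ≢ 0# →
                    Dependent (a ∷ rs)
  dependent-pivot {d} {m} IH (h ∷ t) rs h≢0 with inverse h h≢0
  ... | h⁻¹ , h*h⁻¹≡1 = (c₁ ∷ c) , c₁∷c≢𝟘 ,
    trans (cong (c₁ ⊙ (h ∷ t) ⊕_) (lc-head-tail c rs)) (cong₂ _∷_ head≡0 tail≡𝟘)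
    where
    s : Vec Carrier d
    s = (- h⁻¹) ⊙ t
    reduced : Dependent (map (λ r → tail r ⊕ head r ⊙ s) rs)
    reduced = IH _
    c : Vec Carrier m
    c = proj₁ reduced
    D : Carrier
    D = dot c (map head rs)
    c₁ : Carrier
    c₁ = D * (- h⁻¹)
    c₁∷c≢𝟘 : c₁ ∷ c ≢ 𝟘
    c₁∷c≢𝟘 e = proj₁ (proj₂ reduced) (cong tail e)
    head≡0 : (c₁ * h) + D ≡ 0#
    head≡0 = begin
      (c₁ * h) + D            ≡⟨ cong (_+ D) (*-assoc D (- h⁻¹) h) ⟩
      (D * ((- h⁻¹) * h)) + D ≡⟨ cong (λ z → (D * z) + D) (sym (-‿distribˡ-* h⁻¹ h)) ⟩
      (D * (- (h⁻¹ * h))) + D ≡⟨ cong (λ z → (D * (- z)) + D) (trans (*-comm h⁻¹ h) h*h⁻¹≡1) ⟩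
      (D * (- 1#)) + D        ≡⟨ cong (_+ D) (sym (-‿distribʳ-* D 1#)) ⟩
      (- (D * 1#)) + D        ≡⟨ cong (λ z → (- z) + D) (*-identityʳ D) ⟩
      (- D) + D               ≡⟨ -‿inverseˡ D ⟩
      0#                      ∎
    tail≡𝟘 : c₁ ⊙ t ⊕ lc c (map tail rs) ≡ 𝟘
    tail≡𝟘 = begin
      c₁ ⊙ t ⊕ lc c (map tail rs) ≡⟨ cong (_⊕ lc c (map tail rs)) (⊙-assoc D (- h⁻¹) t) ⟩
      D ⊙ s ⊕ lc c (map tail rs)  ≡⟨ ⊕-comm _ _ ⟩
      lc c (map tail rs) ⊕ D ⊙ s  ≡⟨ sym (lc-eliminate c rs s) ⟩
      lc c (map (λ r → tail r ⊕ head r ⊙ s) rs) ≡⟨ proj₂ (proj₂ reduced) ⟩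
      𝟘                           ∎

  dependent-shear : ∀ {d m} (a : Vec Carrier d) (u : Vec Carrier m) (rs : Vec (Vec Carrier d) m) →
                    Dependent ((a ⊕ lc u rs) ∷ rs) → Dependent (a ∷ rs)
  dependent-shear a u rs ((c₁ ∷ c) , c₁∷c≢𝟘 , combination≡𝟘) = (c₁ ∷ (c ⊕ c₁ ⊙ u)) , nontrivial , combination
    where
    combination : c₁ ⊙ a ⊕ lc (c ⊕ c₁ ⊙ u) rs ≡ 𝟘
    combination = begin
      c₁ ⊙ a ⊕ lc (c ⊕ c₁ ⊙ u) rs           ≡⟨ cong (c₁ ⊙ a ⊕_) (lc-⊕ c (c₁ ⊙ u) rs) ⟩
      c₁ ⊙ a ⊕ (lc c rs ⊕ lc (c₁ ⊙ u) rs)   ≡⟨ cong (λ z → c₁ ⊙ a ⊕ (lc c rs ⊕ z)) (lc-⊙ c₁ u rs) ⟩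
      c₁ ⊙ a ⊕ (lc c rs ⊕ c₁ ⊙ lc u rs)     ≡⟨ cong (c₁ ⊙ a ⊕_) (⊕-comm _ _) ⟩
      c₁ ⊙ a ⊕ (c₁ ⊙ lc u rs ⊕ lc c rs)     ≡⟨ sym (⊕-assoc _ _ _) ⟩
      c₁ ⊙ a ⊕ c₁ ⊙ lc u rs ⊕ lc c rs       ≡⟨ cong (_⊕ lc c rs) (sym (⊙-distribˡ c₁ a _)) ⟩
      c₁ ⊙ (a ⊕ lc u rs) ⊕ lc c rs          ≡⟨ combination≡𝟘 ⟩
      𝟘                                      ∎
    nontrivial : c₁ ∷ (c ⊕ c₁ ⊙ u) ≢ 𝟘
    nontrivial e with c₁ ≟ 0#
    ... | no c₁≢0 = c₁≢0 (cong head e)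
    ... | yes c₁≡0 = c₁∷c≢𝟘 (cong₂ _∷_ c₁≡0 c≡𝟘)
      where
      c≡𝟘 : c ≡ 𝟘
      c≡𝟘 = begin
        c              ≡⟨ sym (⊕-identityʳ c) ⟩
        c ⊕ 𝟘          ≡⟨ cong (c ⊕_) (sym (⊙-zeroˡ u)) ⟩
        c ⊕ 0# ⊙ u     ≡⟨ cong (λ z → c ⊕ z ⊙ u) (sym c₁≡0) ⟩
        c ⊕ c₁ ⊙ u     ≡⟨ cong tail e ⟩
        𝟘              ∎

  dependent-tails : ∀ {d m} (as : Vec (Vec Carrier (suc d)) m) →
                    map head as ≡ 𝟘 → Dependent (map tail as) → Dependent as
  dependent-tails as heads≡𝟘 (c , c≢𝟘 , tails≡𝟘) =
    c , c≢𝟘 , trans (lc-head-tail c as) (cong₂ _∷_ (trans (cong (dot c) heads≡𝟘) (dot-zeroʳ c)) tails≡𝟘)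

  zero-or-shear-nonzero : ∀ {m} h (hs : Vec Carrier m) → h ∷ hs ≡ 𝟘 ⊎ Σ _ λ u → h + dot u hs ≢ 0#
  zero-or-shear-nonzero h hs with h ≟ 0#
  ... | no h≢0 = inj₂ (𝟘 , λ e → h≢0 (trans (sym (trans (cong (h +_) (dot-zeroˡ hs)) (+-identityʳ h))) e))
  zero-or-shear-nonzero h [] | yes h≡0 = inj₁ (cong (_∷ []) h≡0)
  zero-or-shear-nonzero h (y ∷ ys) | yes h≡0 with zero-or-shear-nonzero y ys
  ... | inj₁ y∷ys≡𝟘 = inj₁ (cong₂ _∷_ h≡0 y∷ys≡𝟘)
  ... | inj₂ (u , y+u·ys≢0) = inj₂ ((1# ∷ u) , λ e → y+u·ys≢0 (trans (sym shear≡) e))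
    where
    shear≡ : h + ((1# * y) + dot u ys) ≡ y + dot u ys
    shear≡ = trans (cong₂ _+_ h≡0 (cong (_+ dot u ys) (*-identityˡ y))) (+-identityˡ _)

  more-vectors-than-coordinates⇒dependent : ∀ {d m} → d < m → (as : Vec (Vec Carrier d) m) → Dependent as
  more-vectors-than-coordinates⇒dependent {zero} {suc _} _ as =
    (1# ∷ 𝟘) , (λ e → 0≢1 (sym (cong head e))) , empty≡𝟘 (lc (1# ∷ 𝟘) as)
    where
    empty≡𝟘 : (v : Vec Carrier 0) → v ≡ 𝟘
    empty≡𝟘 [] = refl
  more-vectors-than-coordinates⇒dependent {suc d} {suc m} (s≤s d<m) (a@(h ∷ t) ∷ rs)
    with zero-or-shear-nonzero h (map head rs)
  ... | inj₁ heads≡𝟘 =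
    dependent-tails (a ∷ rs) heads≡𝟘 (more-vectors-than-coordinates⇒dependent (m≤n⇒m≤1+n d<m) _)
  ... | inj₂ (u , pivot≢0) =
    dependent-shear a u rs (dependent-pivot (more-vectors-than-coordinates⇒dependent d<m) (a ⊕ lc u rs) rs
      (λ e → pivot≢0 (trans (sym (cong (λ v → head (a ⊕ v)) (lc-head-tail u rs))) e)))

  Independent : ∀ {d m} → Vec (Vec Carrier m) d → Set
  Independent s = ∀ c → lc c s ≡ 𝟘 → c ≡ 𝟘

  Span : ∀ {d m} → Vec (Vec Carrier m) d → Vec Carrier m → Set
  Span w v = Σ _ λ a → lc a w ≡ v

  coordinates : ∀ {m d n} {w : Vec (Vec Carrier n) d} (s : Vec (Vec Carrier n) m) → All (Span w) s →
                Σ (Vec (Vec Carrier d) m) λ as → map (λ a → lc a w) as ≡ s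
  coordinates [] [] = [] , refl
  coordinates (v ∷ s) ((a , a·w≡v) ∷ s⊆⟨w⟩) with coordinates s s⊆⟨w⟩
  ... | as , as·w≡s = (a ∷ as) , cong₂ _∷_ a·w≡v as·w≡s

  independent-in-span⇒≤ : ∀ {m d n} (s : Vec (Vec Carrier n) m) (w : Vec (Vec Carrier n) d) →
                          Independent s → All (Span w) s → m ≤ d
  independent-in-span⇒≤ s w s-indep s⊆⟨w⟩ = ≮⇒≥ λ d<m →
    let as , as·w≡s = coordinates s s⊆⟨w⟩
        c , c≢𝟘 , c·as≡𝟘 = more-vectors-than-coordinates⇒dependent d<m as
    in c≢𝟘 (s-indep c (begin
         lc c s                       ≡⟨ cong (lc c) (sym as·w≡s) ⟩
         lc c (map (λ a → lc a w) as) ≡⟨ lc-lc c as w ⟩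
         lc (lc c as) w               ≡⟨ cong (λ z → lc z w) c·as≡𝟘 ⟩
         lc 𝟘 w                       ≡⟨ lc-zeroˡ w ⟩
         𝟘                            ∎))

  solve-⊙⊕≡𝟘 : ∀ {m} c₀ c₀⁻¹ (x y : Vec Carrier m) → c₀⁻¹ * c₀ ≡ 1# → c₀ ⊙ x ⊕ y ≡ 𝟘 → x ≡ (- c₀⁻¹) ⊙ y
  solve-⊙⊕≡𝟘 c₀ c₀⁻¹ [] [] _ _ = refl
  solve-⊙⊕≡𝟘 c₀ c₀⁻¹ (a ∷ x) (b ∷ y) inv e = cong₂ _∷_ a≡ (solve-⊙⊕≡𝟘 c₀ c₀⁻¹ x y inv (cong tail e))
    where
    a≡ : a ≡ (- c₀⁻¹) * b
    a≡ = begin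
      a                   ≡⟨ sym (*-identityˡ a) ⟩
      1# * a              ≡⟨ cong (_* a) (sym inv) ⟩
      (c₀⁻¹ * c₀) * a     ≡⟨ *-assoc c₀⁻¹ c₀ a ⟩
      c₀⁻¹ * (c₀ * a)     ≡⟨ cong (c₀⁻¹ *_) (+-inverseˡ-unique (c₀ * a) b (cong head e)) ⟩
      c₀⁻¹ * (- b)        ≡⟨ sym (-‿distribʳ-* c₀⁻¹ b) ⟩
      - (c₀⁻¹ * b)        ≡⟨ -‿distribˡ-* c₀⁻¹ b ⟩
      (- c₀⁻¹) * b        ∎

  independent-∷ : ∀ {d n} (w : Vec (Vec Carrier n) d) (x : Vec Carrier n) →
                  Independent w → ¬ Span w x → Independent (x ∷ w)
  independent-∷ w x w-indep x∉⟨w⟩ (c₀ ∷ c) c₀x+cw≡𝟘 with c₀ ≟ 0#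
  ... | yes c₀≡0 = cong₂ _∷_ c₀≡0 (w-indep c (begin
        lc c w             ≡⟨ sym (⊕-identityˡ _) ⟩
        𝟘 ⊕ lc c w         ≡⟨ cong (_⊕ lc c w) (sym (⊙-zeroˡ x)) ⟩
        0# ⊙ x ⊕ lc c w    ≡⟨ cong (λ z → z ⊙ x ⊕ lc c w) (sym c₀≡0) ⟩
        c₀ ⊙ x ⊕ lc c w    ≡⟨ c₀x+cw≡𝟘 ⟩
        𝟘                  ∎))
  ... | no c₀≢0 with inverse c₀ c₀≢0
  ...   | c₀⁻¹ , c₀c₀⁻¹≡1 = ⊥-elim (x∉⟨w⟩ ((- c₀⁻¹) ⊙ c , trans (lc-⊙ (- c₀⁻¹) c w) (sym x≡)))
    where
    x≡ : x ≡ (- c₀⁻¹) ⊙ lc c w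
    x≡ = solve-⊙⊕≡𝟘 c₀ c₀⁻¹ x (lc c w) (trans (*-comm c₀⁻¹ c₀) c₀c₀⁻¹≡1) c₀x+cw≡𝟘

  record Basis {n} (U : Vec Carrier n → Set) (d : ℕ) : Set where
    field
      vectors     : Vec (Vec Carrier n) d
      independent : Independent vectors
      spanning    : ∀ u → U u → Span vectors u
      members     : All U vectors

  dim-unique : ∀ {n d d'} {U U' : Vec Carrier n → Set} → (∀ v → U v → U' v) → (∀ v → U' v → U v) →
               Basis U d → Basis U' d' → d ≡ d'
  dim-unique U⊆U' U'⊆U b b' = ≤-antisym
    (independent-in-span⇒≤ B.vectors B'.vectors B.independent
      (All.map (λ {v} Uv → B'.spanning v (U⊆U' v Uv)) B.members))
    (independent-in-span⇒≤ B'.vectors B.vectors B'.independent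
      (All.map (λ {v} U'v → B.spanning v (U'⊆U v U'v)) B'.members))
    where
    module B = Basis b
    module B' = Basis b'

  independent-spans : ∀ {d n} {U : Vec Carrier n → Set} → Basis U d →
                      (s : Vec (Vec Carrier n) d) → Independent s → All U s → ∀ u → U u → ¬ ¬ Span s u
  independent-spans b s s-indep s⊆U u Uu u∉⟨s⟩ = <-irrefl refl
    (independent-in-span⇒≤ (u ∷ s) B.vectors (independent-∷ s u s-indep u∉⟨s⟩)
      (B.spanning u Uu ∷ All.map (λ {v} → B.spanning v) s⊆U))
    where
    module B = Basis b

  all-combinations⇒All : ∀ {d n} (P : Vec Carrier n → Set) (w : Vec (Vec Carrier n) d) →
                         (∀ c → P (lc c w)) → All P w
  all-combinations⇒All P [] _ = []
  all-combinations⇒All P (w₁ ∷ ws) P-lc =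
    subst P (trans (cong₂ _⊕_ (⊙-identityˡ w₁) (lc-zeroˡ ws)) (⊕-identityʳ w₁)) (P-lc (1# ∷ 𝟘))
    ∷ all-combinations⇒All P ws (λ c → subst P (trans (cong (_⊕ lc c ws) (⊙-zeroˡ w₁)) (⊕-identityˡ _)) (P-lc (0# ∷ c)))

AbsentAtPredecessor : ∀ {k} → (Fin k → Set) → Fin k → Set
AbsentAtPredecessor P zero = ⊤
AbsentAtPredecessor P (suc e) = ¬ P (inject₁ e)

-- Membership in a chain member is undecidable, so the first index is only found up to ¬ ¬.
first-occurrence : ∀ {k} (P : Fin k → Set) (e : Fin k) → P e →
                   ¬ ¬ Σ (Fin k) λ e → P e × AbsentAtPredecessor P e
first-occurrence {suc k} P = <-weakInduction (λ e → P e → ¬ ¬ Σ _ λ e → P e × AbsentAtPredecessor P e)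
  (λ P₀ κ → κ (zero , P₀ , tt))
  (λ i IH Pᵢ₊₁ κ → κ (suc i , Pᵢ₊₁ , λ Pᵢ → IH Pᵢ κ))

module ShellingOrder (F : FiniteField) (O : AdmissibleOrder F) (n : ℕ) where
  open FiniteField F
  open AdmissibleOrder O
  open Setup F O n
  open LinearAlgebra F
  private module ≺ = IsStrictTotalOrder isStrictTotalOrder

  ≺v-irrefl : ∀ {m} (u : Vec Carrier m) → ¬ u ≺v u
  ≺v-irrefl (x ∷ u) (here x≺x) = ≺.irrefl refl x≺x
  ≺v-irrefl (x ∷ u) (there u≺u) = ≺v-irrefl u u≺u

  ≺v-trans : ∀ {m} {u v w : Vec Carrier m} → u ≺v v → v ≺v w → u ≺v w
  ≺v-trans (here p) (here q) = here (≺.trans p q)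
  ≺v-trans (here p) (there _) = here p
  ≺v-trans (there _) (here q) = here q
  ≺v-trans (there p) (there q) = there (≺v-trans p q)

  ≼-≺v-trans : ∀ {m} {u v w : Vec Carrier m} → u ≡ v ⊎ u ≺v v → v ≺v w → u ≺v w
  ≼-≺v-trans (inj₁ refl) v≺w = v≺w
  ≼-≺v-trans (inj₂ u≺v) v≺w = ≺v-trans u≺v v≺w

  ≺v⇒¬≼ : ∀ {m} {u v : Vec Carrier m} → u ≺v v → ¬ (v ≡ u ⊎ v ≺v u)
  ≺v⇒¬≼ {u = u} u≺u (inj₁ refl) = ≺v-irrefl u u≺u
  ≺v⇒¬≼ {u = u} u≺v (inj₂ v≺u) = ≺v-irrefl u (≺v-trans u≺v v≺u)

  ≺l-unique-difference : ∀ {k} {C D : Chain k} {e : Fin k} →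
                         D ≺l C → (∀ i → i ≢ e → C i ≐ D i) → D e ≺q C e
  ≺l-unique-difference {e = e} (f , Df≉Cf , _ , Df≺Cf) agree with f Fin.≟ e
  ... | yes refl = Df≺Cf
  ... | no f≢e = ⊥-elim (Df≉Cf (swap (agree f f≢e)))

  lincomb≡lc : ∀ {d} (c : Vec Carrier d) (b : Vec V d) → lincomb c b ≡ lc c b
  lincomb≡lc [] [] = refl
  lincomb≡lc (c ∷ cs) (b ∷ bs) = cong ((c ·v b) +v_) (lincomb≡lc cs bs)

  Dim⇒Basis : ∀ {U d} → Dim U d → Basis U d
  Dim⇒Basis {U} (b , indep , spanning , closed) = record
    { vectors = b
    ; independent = λ c c·b≡𝟘 → indep c (trans (lincomb≡lc c b) c·b≡𝟘)
    ; spanning = λ u Uu → let c , c·b≡u = spanning u Uu in c , trans (sym (lincomb≡lc c b)) c·b≡u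
    ; members = all-combinations⇒All U b (λ c → subst U (lincomb≡lc c b) (closed c))
    }

  lc-closed : ∀ {U} → IsSubspace U → ∀ {d} {s : Vec V d} → All U s → ∀ c → U (lc c s)
  lc-closed (U0 , _ , _) [] [] = U0
  lc-closed U@(_ , +-closed , ·-closed) (Uv ∷ Us) (c ∷ cs) = +-closed _ _ (·-closed c _ Uv) (lc-closed U Us cs)

  ⟨⟩-subspace : ∀ a → IsSubspace ⟨ a ⟩
  ⟨⟩-subspace a = (0# , sym (⊙-zeroˡ a))
                , (λ { u w (c , u≡ca) (c' , w≡c'a) →
                         (c + c') , trans (cong₂ _+v_ u≡ca w≡c'a) (sym (⊙-distribʳ c c' a)) })
                , (λ { c u (c' , u≡c'a) → (c * c') , trans (cong (c ·v_) u≡c'a) (sym (⊙-assoc c c' a)) })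

  Atom : Complex → V → Set
  Atom Δ v = (v ≢ 0v) × Δ ⟨ v ⟩

  module _ (Δ : Complex) (qc : IsQComplex Δ) {k : ℕ} where

    face-subspace : ∀ {U} → Δ U → IsSubspace U
    face-subspace {U} = proj₁ qc U

    minimal-atom-≼ : ∀ {x U a} → IsMin (Atom Δ) x → Δ U → U a → a ≢ 0v → x ≡ a ⊎ x ≺v a
    minimal-atom-≼ {U = U} {a} x-min ΔU Ua a≢0 = proj₂ x-min a (a≢0 , Δ⟨a⟩)
      where
      ⟨a⟩⊆U : ⟨ a ⟩ ⊆ U
      ⟨a⟩⊆U v (c , v≡ca) = subst U (sym v≡ca) (proj₂ (proj₂ (face-subspace ΔU)) c a Ua)
      Δ⟨a⟩ : Δ ⟨ a ⟩
      Δ⟨a⟩ = proj₂ qc U ⟨ a ⟩ ΔU (⟨⟩-subspace a) ⟨a⟩⊆U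

    level-unique : ∀ {C D : Chain k} {i l} → IsMaxChain Δ k C → IsMaxChain Δ k D → C i ≐ D l → i ≡ l
    level-unique {i = i} {l} mcC mcD (Ci⊆Dl , Dl⊆Ci) = toℕ-injective (suc-injective
      (dim-unique Ci⊆Dl Dl⊆Ci (Dim⇒Basis (proj₂ (proj₁ mcC i))) (Dim⇒Basis (proj₂ (proj₁ mcD l)))))

    record SharedLowerBasis (C D : Chain k) (x : V) (e : Fin k) : Set where
      field
        vectors     : Vec V (toℕ e)
        independent : Independent vectors
        avoids      : ¬ Span vectors x
        in-C        : All (C e) vectors
        in-D        : All (D e) vectors

    lower-basis : ∀ {C D : Chain k} {x} → x ≢ 0v → IsMaxChain Δ k C → IsMaxChain Δ k D →
                  (e : Fin k) → AbsentAtPredecessor (λ i → C i x) e → (∀ i → i ≢ e → C i ≐ D i) →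
                  SharedLowerBasis C D x e
    lower-basis x≢0 _ _ zero _ _ = record
      { vectors = [] ; independent = λ { [] _ → refl } ; avoids = λ { ([] , 0≡x) → x≢0 (sym 0≡x) }
      ; in-C = [] ; in-D = [] }
    lower-basis {C} {x = x} _ mcC mcD (suc e) x∉Cₑ agree = record
      { vectors = vectors ; independent = independent ; avoids = avoids
      ; in-C = All.map (λ {v} → proj₂ mcC p (suc e) p<e+1 v) members
      ; in-D = All.map (λ {v} Cₚv → proj₂ mcD p (suc e) p<e+1 v (proj₁ (agree p p≢e+1) v Cₚv)) members }
      where
      p : Fin k
      p = inject₁ e
      open Basis (subst (λ j → Basis (C p) (suc j)) (toℕ-inject₁ e) (Dim⇒Basis (proj₂ (proj₁ mcC p))))
      avoids : ¬ Span vectors x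
      avoids (c , c·w≡x) = x∉Cₑ (subst (C p) c·w≡x (lc-closed (face-subspace (proj₁ (proj₁ mcC p))) members c))
      p<e+1 : toℕ p < toℕ (suc e)
      p<e+1 = s≤s (≤-reflexive (toℕ-inject₁ e))
      p≢e+1 : p ≢ suc e
      p≢e+1 p≡e+1 = <⇒≢ p<e+1 (cong toℕ p≡e+1)

    lower-basis-covers : ∀ {C D : Chain k} {x e} → IsMaxChain Δ k C → IsMaxChain Δ k D →
                         SharedLowerBasis C D x e → C e x → D e x → ∀ v → C e v → ¬ ¬ D e v
    lower-basis-covers {D = D} {x} {e} mcC mcD w Cₑx Dₑx v Cₑv v∉Dₑ =
      independent-spans (Dim⇒Basis (proj₂ (proj₁ mcC e))) (x ∷ vectors)
        (independent-∷ vectors x independent avoids) (Cₑx ∷ in-C) v Cₑv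
        λ (c , c·xw≡v) → v∉Dₑ (subst (D e) c·xw≡v (lc-closed Dₑ-subspace (Dₑx ∷ in-D) c))
      where
      open SharedLowerBasis w
      Dₑ-subspace : IsSubspace (D e)
      Dₑ-subspace = face-subspace (proj₁ (proj₁ mcD e))

    first-entry-∉-restriction : ∀ {C : Chain k} {x} → IsMaxChain Δ k C → IsMin (Atom Δ) x →
                                (e : Fin k) → C e x → AbsentAtPredecessor (λ i → C i x) e →
                                ¬ InRestriction Δ k C e
    first-entry-∉-restriction {C} {x} mcC x-min e Cₑx fresh (D , mcD , D≺C , shared) =
      refute (≺l-unique-difference D≺C agree)
      where
      agree : ∀ i → i ≢ e → C i ≐ D i
      agree i i≢e = let l , Cᵢ≐Dₗ = shared i i≢e in
        subst (λ j → C i ≐ D j) (sym (level-unique mcC mcD Cᵢ≐Dₗ)) Cᵢ≐Dₗ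
      covers : D e x → ∀ v → C e v → ¬ ¬ D e v
      covers = lower-basis-covers mcC mcD (lower-basis (proj₁ (proj₁ x-min)) mcC mcD e fresh agree) Cₑx
      refute : D e ≺q C e → ⊥
      refute (a , b , ((Dₑa , a∉Cₑ) , _) , ((Cₑb , b∉Dₑ) , b-min) , a≺b) =
        ≺v⇒¬≼ x≺b (b-min x (Cₑx , λ Dₑx → covers Dₑx b Cₑb b∉Dₑ))
        where
        a≢0 : a ≢ 0v
        a≢0 a≡0 = a∉Cₑ (subst (C e) (sym a≡0) (proj₁ (face-subspace (proj₁ (proj₁ mcC e)))))
        x≺b : x ≺v b
        x≺b = ≼-≺v-trans (minimal-atom-≼ x-min (proj₁ (proj₁ mcD e)) Dₑa a≢0) a≺b

lemma4p6 : (F : FiniteField) (O : AdmissibleOrder F) (n k : ℕ) →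
    let open Setup F O n in
    (Δ : Complex) → IsQComplex Δ → LexShellable Δ k →
    (C : Chain k) → IsMaxChain Δ k C →
    (Fj : Sub) → IsFacet Δ Fj →
    (top : Fin k) → suc (toℕ top) ≡ k → C top ≐ Fj →
    (x : V) → IsMin (λ v → (v ≢ 0v) × Δ ⟨ v ⟩) x →
    Fj x →
    ¬ (∀ e → InRestriction Δ k C e)
lemma4p6 F O n k Δ qc _ C mcC _ _ top _ (_ , Fj⊆Cₜₒₚ) x x-min Fj-x all-in-restriction =
  first-occurrence (λ i → C i x) top (Fj⊆Cₜₒₚ x Fj-x) λ (e , Cₑx , fresh) →
    first-entry-∉-restriction Δ qc mcC x-min e Cₑx fresh (all-in-restriction e)
  where open ShellingOrder F O n
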